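{- Let \(D\) be a \(\mathcal V\)-dcpo. (i) \(D\) has a small basis if and only if it is isomorphic to \(\mathrm{Idl}_{\mathcal V}(B,\prec)\) for some abstract \(\mathcal V\)-basis \((B,\prec)\). (ii) \(D\) has a small compact basis if and only if it is isomorphic to \(\mathrm{Idl}_{\mathcal V}(B,\prec)\) for some abstract \(\mathcal V\)-basis \((B,\prec)\) with \(\prec\) reflexive. (iii) \(D\) has a small basis if and only if it is a Scott continuous retract of a \(\mathcal V\)-dcpo with a small compact basis. In particular, every \(\mathcal V\)-dcpo with a small basis is isomorphic to a \(\mathcal V\)-dcpo whose order takes values in \(\mathcal V\) and whose carrier lives in \(\mathcal V^+\).
   Context: We work constructively and predicatively in univalent foundations with universes (\(\mathcal V^+\) the successor universe of \(\mathcal V\)) and propositional truncation. A type is \(\mathcal V\)-small if equivalent to a type in \(\mathcal V\). Directed family: inhabited index and any two indices have (there exists) a common upper index. \(\mathcal V\)-dcpo: poset (set carrier, proposition-valued order) with suprema of directed families indexed by types in \(\mathcal V\); Scott continuous maps preserve them. Way-below: \(x\ll y\) iff for every directed \(\alpha:I\to D\), \(I:\mathcal V\), with \(y\sqsubseteq\bigsqcup\alpha\) there exists \(i\) with \(x\sqsubseteq\alpha_i\); compact means \(x\ll x\). Small basis: \(\beta:B\to D\), \(B:\mathcal V\), with each family \(\Sigma_{b:B}(\beta(b)\ll x)\to D\) (via \(\beta\)) directed with supremum \(x\), and each \(\beta(b)\ll x\) \(\mathcal V\)-small. Small compact basis: \(\beta:B\to D\), \(B:\mathcal V\), each \(\beta(b)\)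 compact, each \(\Sigma_{b:B}(\beta(b)\sqsubseteq x)\to D\) directed with supremum \(x\), each \(\beta(b)\sqsubseteq x\) \(\mathcal V\)-small. Abstract \(\mathcal V\)-basis: \(B:\mathcal V\) with proposition-valued transitive \(\prec:B\to B\to\mathcal V\) such that every \(a\) has (there exists) some \(b\prec a\), and \(a_1,a_2\prec b\) implies there is \(a\) with \(a_1,a_2\prec a\prec b\). Ideals: subsets \(I:B\to\Omega_{\mathcal V}\) that are \(\prec\)-lower sets and \(\prec\)-directed (inhabited; any two members have a common \(\prec\)-upper bound in \(I\)); \(\mathrm{Idl}_{\mathcal V}(B,\prec)\) is the \(\mathcal V\)-dcpo of ideals under inclusion, with carrier in \(\mathcal V^+\) and order valued in \(\mathcal V\). Scott continuous retract: Scott continuous \(s:D\to E\), \(r:E\to D\) with \(r\circ s=\mathrm{id}\). -}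

module Defs where

-- Function extensionality, propositional extensionality and propositional
-- truncation are NOT available in --safe Agda, so they are taken as explicit
-- hypotheses (records / types below) of the theorem.

open import Level using (Level; _⊔_; Setω) renaming (suc to lsuc)
open import Data.Unit using (⊤; tt)
open import Data.Product using (Σ; Σ-syntax; _×_; _,_; proj₁; proj₂)
open import Relation.Binary.PropositionalEquality
  using (_≡_; refl; sym; trans; cong; subst; trans-symˡ)
open import Function.Bundles using (_↔_)

isProp : ∀ {ℓ} → Set ℓ → Set ℓ
isProp X = (x y : X) → x ≡ y

isSet : ∀ {ℓ} → Set ℓ → Set ℓ
isSet X = (x y : X) → isProp (x ≡ y)

FunExt : Setω
FunExt = ∀ {a b} {A : Set a} {B : A → Set b} {f g : (x : A) → B x}
       → (∀ x → f x ≡ g x) → f ≡ g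

PropExt : Setω
PropExt = ∀ {ℓ} {P Q : Set ℓ} → isProp P → isProp Q → (P → Q) → (Q → P) → P ≡ Q

record PropTrunc : Setω where
  field
    ∥_∥      : ∀ {ℓ} → Set ℓ → Set ℓ
    ∥∥-isProp : ∀ {ℓ} {X : Set ℓ} → isProp ∥ X ∥
    ∣_∣      : ∀ {ℓ} {X : Set ℓ} → X → ∥ X ∥
    ∥∥-rec   : ∀ {ℓ ℓ'} {X : Set ℓ} {P : Set ℓ'} → isProp P → (X → P) → ∥ X ∥ → P

rijke : ∀ {ℓ ℓ'} {X : Set ℓ} (R : X → X → Set ℓ')
      → (∀ x y → isProp (R x y)) → (∀ x → R x x)
      → (∀ x y → R x y → x ≡ y) → isSet X
rijke {X = X} R Rp ρ f x y p q =
  trans (g y p) (trans (cong (λ r → trans (sym e) (f x y r))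
                             (Rp x y (subst (R x) p (ρ x)) (subst (R x) q (ρ x))))
                       (sym (g y q)))
  where
  e = f x x (ρ x)
  g : ∀ z (p : x ≡ z) → p ≡ trans (sym e) (f x z (subst (R x) p (ρ x)))
  g _ refl = sym (trans-symˡ e)

isProp⇒isSet : ∀ {ℓ} {X : Set ℓ} → isProp X → isSet X
isProp⇒isSet pX = rijke (λ _ _ → ⊤) (λ _ _ _ _ → refl) (λ _ → tt) (λ x y _ → pX x y)

isProp-isProp : FunExt → ∀ {ℓ} {X : Set ℓ} → isProp (isProp X)
isProp-isProp fe p q = fe λ x → fe λ y → isProp⇒isSet p x y (p x y) (q x y)

module WithPT (pt : PropTrunc) where
  open PropTrunc pt public

  ∥∥-map : ∀ {ℓ ℓ'} {X : Set ℓ} {Y : Set ℓ'} → (X → Y) → ∥ X ∥ → ∥ Y ∥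
  ∥∥-map f = ∥∥-rec ∥∥-isProp (λ x → ∣ f x ∣)

  isSmall : (𝓥 : Level) {ℓ : Level} → Set ℓ → Set (lsuc 𝓥 ⊔ ℓ)
  isSmall 𝓥 X = Σ[ Y ∈ Set 𝓥 ] (Y ↔ X)

  isDirected : ∀ {ℓ ℓ' ℓi} {X : Set ℓ} (R : X → X → Set ℓ') {I : Set ℓi}
             → (I → X) → Set (ℓ' ⊔ ℓi)
  isDirected R {I} α = ∥ I ∥
    × (∀ i j → ∥ Σ[ k ∈ I ] (R (α i) (α k) × R (α j) (α k)) ∥)

  isSup : ∀ {ℓ ℓ' ℓi} {X : Set ℓ} (R : X → X → Set ℓ') {I : Set ℓi}
        → (I → X) → X → Set (ℓ ⊔ ℓ' ⊔ ℓi)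
  isSup {X = X} R {I} α x = (∀ i → R (α i) x) × (∀ y → (∀ i → R (α i) y) → R x y)

  record DCPO (𝓥 𝓤 𝓣 : Level) : Set (lsuc 𝓥 ⊔ lsuc 𝓤 ⊔ lsuc 𝓣) where
    field
      ⟨_⟩        : Set 𝓤
      _⊑_        : ⟨_⟩ → ⟨_⟩ → Set 𝓣
      carrier-set : isSet ⟨_⟩
      ⊑-prop     : ∀ x y → isProp (x ⊑ y)
      ⊑-refl     : ∀ x → x ⊑ x
      ⊑-trans    : ∀ x y z → x ⊑ y → y ⊑ z → x ⊑ z
      ⊑-antisym  : ∀ x y → x ⊑ y → y ⊑ x → x ≡ y
      ⋁          : {I : Set 𝓥} (α : I → ⟨_⟩) → isDirected _⊑_ α → ⟨_⟩
      ⋁-isSup    : {I : Set 𝓥} (α : I → ⟨_⟩) (δ : isDirected _⊑_ α) → isSup _⊑_ α (⋁ α δ)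

  open DCPO public

  wayBelow : ∀ {𝓥 𝓤 𝓣} (D : DCPO 𝓥 𝓤 𝓣) → ⟨ D ⟩ → ⟨ D ⟩ → Set (lsuc 𝓥 ⊔ 𝓤 ⊔ 𝓣)
  wayBelow {𝓥} D x y = ∀ {I : Set 𝓥} (α : I → ⟨ D ⟩) (δ : isDirected (_⊑_ D) α)
              → _⊑_ D y (⋁ D α δ) → ∥ Σ[ i ∈ I ] (_⊑_ D x (α i)) ∥

  isCompact : ∀ {𝓥 𝓤 𝓣} (D : DCPO 𝓥 𝓤 𝓣) → ⟨ D ⟩ → Set (lsuc 𝓥 ⊔ 𝓤 ⊔ 𝓣)
  isCompact D x = wayBelow D x x

  module _ {𝓥 𝓤 𝓣 : Level} (D : DCPO 𝓥 𝓤 𝓣) where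
    _≪_ : ⟨ D ⟩ → ⟨ D ⟩ → Set (lsuc 𝓥 ⊔ 𝓤 ⊔ 𝓣)
    x ≪ y = wayBelow D x y

    isSmallBasis : {B : Set 𝓥} → (B → ⟨ D ⟩) → Set (lsuc 𝓥 ⊔ 𝓤 ⊔ 𝓣)
    isSmallBasis {B} β =
        (∀ x → isDirected (_⊑_ D) {Σ[ b ∈ B ] (β b ≪ x)} (λ p → β (proj₁ p)))
      × (∀ x → isSup (_⊑_ D) {Σ[ b ∈ B ] (β b ≪ x)} (λ p → β (proj₁ p)) x)
      × (∀ b x → isSmall 𝓥 (β b ≪ x))

    hasSmallBasis : Set (lsuc 𝓥 ⊔ 𝓤 ⊔ 𝓣)
    hasSmallBasis = ∥ Σ[ B ∈ Set 𝓥 ] Σ[ β ∈ (B → ⟨ D ⟩) ] isSmallBasis β ∥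

    isSmallCompactBasis : {B : Set 𝓥} → (B → ⟨ D ⟩) → Set (lsuc 𝓥 ⊔ 𝓤 ⊔ 𝓣)
    isSmallCompactBasis {B} β =
        (∀ b → isCompact D (β b))
      × (∀ x → isDirected (_⊑_ D) {Σ[ b ∈ B ] (_⊑_ D (β b) x)} (λ p → β (proj₁ p)))
      × (∀ x → isSup (_⊑_ D) {Σ[ b ∈ B ] (_⊑_ D (β b) x)} (λ p → β (proj₁ p)) x)
      × (∀ b x → isSmall 𝓥 (_⊑_ D (β b) x))

    hasSmallCompactBasis : Set (lsuc 𝓥 ⊔ 𝓤 ⊔ 𝓣)
    hasSmallCompactBasis = ∥ Σ[ B ∈ Set 𝓥 ] Σ[ β ∈ (B → ⟨ D ⟩) ] isSmallCompactBasis β ∥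

  isScottContinuous : ∀ {𝓥 𝓤 𝓣 𝓤' 𝓣'} (D : DCPO 𝓥 𝓤 𝓣) (E : DCPO 𝓥 𝓤' 𝓣')
                    → (⟨ D ⟩ → ⟨ E ⟩) → Set (lsuc 𝓥 ⊔ 𝓤 ⊔ 𝓣 ⊔ 𝓤' ⊔ 𝓣')
  isScottContinuous {𝓥} D E f =
    ∀ {I : Set 𝓥} (α : I → ⟨ D ⟩) (δ : isDirected (_⊑_ D) α)
    → isSup (_⊑_ E) (λ i → f (α i)) (f (⋁ D α δ))

  _◁_ : ∀ {𝓥 𝓤 𝓣 𝓤' 𝓣'} (D : DCPO 𝓥 𝓤 𝓣) (E : DCPO 𝓥 𝓤' 𝓣')
      → Set (lsuc 𝓥 ⊔ 𝓤 ⊔ 𝓣 ⊔ 𝓤' ⊔ 𝓣')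
  D ◁ E = Σ[ s ∈ (⟨ D ⟩ → ⟨ E ⟩) ] Σ[ r ∈ (⟨ E ⟩ → ⟨ D ⟩) ]
            (isScottContinuous D E s × isScottContinuous E D r × (∀ x → r (s x) ≡ x))

  _≅_ : ∀ {𝓥 𝓤 𝓣 𝓤' 𝓣'} (D : DCPO 𝓥 𝓤 𝓣) (E : DCPO 𝓥 𝓤' 𝓣')
      → Set (𝓤 ⊔ 𝓣 ⊔ 𝓤' ⊔ 𝓣')
  D ≅ E = Σ[ f ∈ (⟨ D ⟩ → ⟨ E ⟩) ] Σ[ g ∈ (⟨ E ⟩ → ⟨ D ⟩) ]
            ((∀ x → g (f x) ≡ x) × (∀ y → f (g y) ≡ y)
            × (∀ x y → _⊑_ D x y → _⊑_ E (f x) (f y))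
            × (∀ x y → _⊑_ E x y → _⊑_ D (g x) (g y)))

  record AbstractBasis (𝓥 : Level) : Set (lsuc 𝓥) where
    field
      B       : Set 𝓥
      _≺_     : B → B → Set 𝓥
      ≺-prop  : ∀ a b → isProp (a ≺ b)
      ≺-trans : ∀ a b c → a ≺ b → b ≺ c → a ≺ c
      ≺-interpolation₀ : ∀ a → ∥ Σ[ b ∈ B ] (b ≺ a) ∥
      ≺-interpolation₂ : ∀ a₁ a₂ b → a₁ ≺ b → a₂ ≺ b
                       → ∥ Σ[ a ∈ B ] ((a₁ ≺ a × a₂ ≺ a) × a ≺ b) ∥

  module Ideals {𝓥 : Level} (𝓑 : AbstractBasis 𝓥) where
    open AbstractBasis 𝓑

    record Ideal : Set (lsuc 𝓥) where
      constructor mkIdeal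
      field
        _∋_      : B → Set 𝓥
        ∋-prop   : ∀ b → isProp (_∋_ b)
        lower    : ∀ a b → a ≺ b → _∋_ b → _∋_ a
        inhabited : ∥ Σ[ b ∈ B ] (_∋_ b) ∥
        semidirected : ∀ a b → _∋_ a → _∋_ b
                     → ∥ Σ[ c ∈ B ] (_∋_ c × (a ≺ c × b ≺ c)) ∥
    open Ideal public

    _⊆_ : Ideal → Ideal → Set 𝓥
    I ⊆ J = ∀ b → _∋_ I b → _∋_ J b

    module Construction (fe : FunExt) (pe : PropExt) where

      private
        fields-≡ : ∀ {P pp pp' l l' i i' s s'} → pp ≡ pp' → l ≡ l' → i ≡ i' → s ≡ s'
                 → mkIdeal P pp l i s ≡ mkIdeal P pp' l' i' s'
        fields-≡ refl refl refl refl = refl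

        ideal-ext : ∀ {P P' pp pp' l l' i i' s s'} → P ≡ P'
                  → mkIdeal P pp l i s ≡ mkIdeal P' pp' l' i' s'
        ideal-ext {P} {.P} {pp} {pp'} {l} {l'} {i} {i'} {s} {s'} refl =
          fields-≡ (fe λ b → isProp-isProp fe (pp b) (pp' b))
                   (fe λ a → fe λ b → fe λ r → fe λ x → pp a (l a b r x) (l' a b r x))
                   (∥∥-isProp i i')
                   (fe λ a → fe λ b → fe λ x → fe λ y → ∥∥-isProp (s a b x y) (s' a b x y))

      ⊆-prop : ∀ I J → isProp (I ⊆ J)
      ⊆-prop I J f g = fe λ b → fe λ x → ∋-prop J b (f b x) (g b x)

      ⊆-antisym : ∀ I J → I ⊆ J → J ⊆ I → I ≡ J
      ⊆-antisym (mkIdeal P pp l i s) (mkIdeal P' pp' l' i' s') f g =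
        ideal-ext (fe λ b → pe (pp b) (pp' b) (f b) (g b))

      ⋃ : {I : Set 𝓥} (α : I → Ideal) → isDirected _⊆_ α → Ideal
      ⋃ {I} α (inh , sd) = mkIdeal P Pp Pl Pi Ps
        where
        P : B → Set 𝓥
        P b = ∥ Σ[ i ∈ I ] (_∋_ (α i) b) ∥
        Pp : ∀ b → isProp (P b)
        Pp b = ∥∥-isProp
        Pl : ∀ a b → a ≺ b → P b → P a
        Pl a b r = ∥∥-map λ { (i , x) → i , lower (α i) a b r x }
        Pi : ∥ Σ[ b ∈ B ] P b ∥
        Pi = ∥∥-rec ∥∥-isProp
               (λ i → ∥∥-map (λ { (b , x) → b , ∣ i , x ∣ }) (inhabited (α i))) inh
        Ps : ∀ a b → P a → P b → ∥ Σ[ c ∈ B ] (P c × (a ≺ c × b ≺ c)) ∥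
        Ps a b pa pb =
          ∥∥-rec ∥∥-isProp (λ { (i , xa) →
          ∥∥-rec ∥∥-isProp (λ { (j , xb) →
          ∥∥-rec ∥∥-isProp (λ { (k , ik , jk) →
          ∥∥-map (λ { (c , xc , ac , bc) → c , ∣ k , xc ∣ , ac , bc })
                 (semidirected (α k) a b (ik a xa) (jk b xb)) })
          (sd i j) }) pb }) pa

      Idl : DCPO 𝓥 (lsuc 𝓥) 𝓥
      Idl = record
        { ⟨_⟩ = Ideal
        ; _⊑_ = _⊆_
        ; carrier-set = rijke (λ I J → (I ⊆ J) × (J ⊆ I))
            (λ I J (f , g) (f' , g') → cong₂' (⊆-prop I J f f') (⊆-prop J I g g'))
            (λ I → (λ _ x → x) , (λ _ x → x))
            (λ I J (f , g) → ⊆-antisym I J f g)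
        ; ⊑-prop = ⊆-prop
        ; ⊑-refl = λ I b x → x
        ; ⊑-trans = λ I J K f g b x → g b (f b x)
        ; ⊑-antisym = ⊆-antisym
        ; ⋁ = ⋃
        ; ⋁-isSup = λ α δ → (λ i b x → ∣ i , x ∣)
                          , (λ J h b → ∥∥-rec (∋-prop J b) (λ { (i , x) → h i b x }))
        }
        where
        cong₂' : ∀ {a b} {A : Set a} {C : Set b} {x x' : A} {y y' : C}
               → x ≡ x' → y ≡ y' → (x , y) ≡ (x' , y')
        cong₂' refl refl = refl

  Idl : FunExt → PropExt → ∀ {𝓥} → AbstractBasis 𝓥 → DCPO 𝓥 (lsuc 𝓥) 𝓥
  Idl fe pe 𝓑 = Ideals.Construction.Idl 𝓑 fe pe

-- A small basis β : B → D yields a small approximation relation b ≪ᵇ x,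
-- equivalent to β b ≪ x (or to β b ⊑ x for a compact basis), which
-- interpolates and whose approximants of x are directed with supremum x.
-- Sending x to its set of approximants is then an isomorphism from D onto the
-- ideals of (B, a ≪ᵇ β b), and a section of J ↦ ⋁ β[J] from the ideals of the
-- reflexive basis (B, β a ⊑ β b).  Conversely, principal ideals form a small
-- basis of any ideal completion, compact when the basis is reflexive, and small
-- bases pass to Scott continuous retracts: r (β b) ≪ x holds iff
-- r (β b) ⊑ r (β c) for some c ≪ᵇ s x, and this is small because u ⊑ v in D
-- iff every approximant of s u is an approximant of s v.

module Submission where

open import Defs
open import Level using (Level; _⊔_; Lift; lift) renaming (suc to lsuc)
open import Data.Bool using (Bool; true; false)
open import Data.Product using (Σ; Σ-syntax; _×_; _,_; proj₁; proj₂)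
open import Function.Base using (_∘_)
open import Function.Bundles using (_↔_; Inverse; mk↔ₛ′)
open import Relation.Binary.PropositionalEquality using (_≡_; sym; trans; cong; subst; subst₂)

isProp-↔ : ∀ {a b} {X : Set a} {Y : Set b} → isProp X → Y ↔ X → isProp Y
isProp-↔ pX e y y′ =
  trans (sym (Inverse.strictlyInverseʳ e y))
        (trans (cong (Inverse.from e) (pX _ _)) (Inverse.strictlyInverseʳ e y′))

props-↔ : ∀ {a b} {X : Set a} {Y : Set b}
        → isProp X → isProp Y → (X → Y) → (Y → X) → X ↔ Y
props-↔ pX pY f g = mk↔ₛ′ f g (λ _ → pY _ _) (λ _ → pX _ _)

Π-isProp : FunExt → ∀ {a b} {A : Set a} {P : A → Set b}
         → (∀ x → isProp (P x)) → isProp ((x : A) → P x)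
Π-isProp fe h f g = fe λ x → h x (f x) (g x)

module _ (pt : PropTrunc) where
  open WithPT pt hiding (_⊑_; _≪_; ⊑-refl; ⊑-trans; ⊑-prop; ⊑-antisym; ⋁; ⋁-isSup)

  isSmall-⇔ : ∀ {𝓥 a b} {X : Set a} {Y : Set b} → isProp X → isProp Y
            → (X → Y) → (Y → X) → isSmall 𝓥 X → isSmall 𝓥 Y
  isSmall-⇔ pX pY f g (Z , e) =
    Z , props-↔ (isProp-↔ pX e) pY (f ∘ Inverse.to e) (Inverse.from e ∘ g)

  module _ {ℓ ℓ′ b p q} {X : Set ℓ} (R : X → X → Set ℓ′) {B : Set b} (β : B → X)
           {P : B → Set p} {Q : B → Set q} (f : ∀ {b} → P b → Q b) (g : ∀ {b} → Q b → P b)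
           where

    isDirected-reindex : isDirected R {Σ B P} (β ∘ proj₁) → isDirected R {Σ B Q} (β ∘ proj₁)
    isDirected-reindex (inh , semidir) =
      ∥∥-map (λ (b , pb) → b , f pb) inh ,
      λ (i , qi) (j , qj) → ∥∥-map (λ ((k , pk) , ik , jk) → (k , f pk) , ik , jk)
                                   (semidir (i , g qi) (j , g qj))

    isSup-reindex : ∀ {x} → isSup R {Σ B P} (β ∘ proj₁) x → isSup R {Σ B Q} (β ∘ proj₁) x
    isSup-reindex (upper , least) =
      (λ (b , qb) → upper (b , g qb)) , λ y h → least y (λ (b , pb) → h (b , f pb))

  preorderBasis : ∀ {𝓥} {B : Set 𝓥} (_≺_ : B → B → Set 𝓥)
                → (∀ a b → isProp (a ≺ b)) → (∀ b → b ≺ b)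
                → (∀ {a b c} → a ≺ b → b ≺ c → a ≺ c) → AbstractBasis 𝓥
  preorderBasis {B = B} _≺_ ≺-isProp ≺-refl ≺-trans = record
    { B = B
    ; _≺_ = _≺_
    ; ≺-prop = ≺-isProp
    ; ≺-trans = λ _ _ _ → ≺-trans
    ; ≺-interpolation₀ = λ a → ∣ a , ≺-refl a ∣
    ; ≺-interpolation₂ = λ _ _ b a₁≺b a₂≺b → ∣ b , (a₁≺b , a₂≺b) , ≺-refl b ∣
    }

  ≅-sym : ∀ {𝓥 𝓤 𝓣 𝓤′ 𝓣′} (D : DCPO 𝓥 𝓤 𝓣) (E : DCPO 𝓥 𝓤′ 𝓣′) → D ≅ E → E ≅ D
  ≅-sym _ _ (f , g , gf , fg , f-mono , g-mono) = g , f , fg , gf , g-mono , f-mono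

  module _ (fe : FunExt) where

    module Dcpo {𝓥 𝓤 𝓣 : Level} (D : DCPO 𝓥 𝓤 𝓣) where
      open DCPO D public using (_⊑_; ⊑-prop; ⊑-refl; ⊑-antisym; ⋁)

      _≪_ : ⟨ D ⟩ → ⟨ D ⟩ → Set (lsuc 𝓥 ⊔ 𝓤 ⊔ 𝓣)
      _≪_ = wayBelow D

      ⊑-trans : ∀ {x y z} → x ⊑ y → y ⊑ z → x ⊑ z
      ⊑-trans = DCPO.⊑-trans D _ _ _

      module _ {I : Set 𝓥} (α : I → ⟨ D ⟩) (δ : isDirected _⊑_ α) where

        ⋁-upper : ∀ i → α i ⊑ ⋁ α δ
        ⋁-upper = proj₁ (DCPO.⋁-isSup D α δ)

        ⋁-least : ∀ y → (∀ i → α i ⊑ y) → ⋁ α δ ⊑ y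
        ⋁-least = proj₂ (DCPO.⋁-isSup D α δ)

        isSup⇒⊑⋁ : ∀ {x} → isSup _⊑_ α x → x ⊑ ⋁ α δ
        isSup⇒⊑⋁ (_ , least) = least _ ⋁-upper

        ⋁-unique : ∀ {x} → isSup _⊑_ α x → ⋁ α δ ≡ x
        ⋁-unique s@(upper , _) = ⊑-antisym _ _ (⋁-least _ upper) (isSup⇒⊑⋁ s)

        ≪-isSup : ∀ {x y} → x ≪ y → isSup _⊑_ α y → ∥ Σ[ i ∈ I ] (x ⊑ α i) ∥
        ≪-isSup x≪y s = x≪y α δ (isSup⇒⊑⋁ s)

      pair : ⟨ D ⟩ → ⟨ D ⟩ → Lift 𝓥 Bool → ⟨ D ⟩
      pair x y (lift false) = x
      pair x y (lift true)  = y

      module _ {x y} (x⊑y : x ⊑ y) where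

        pair-below : ∀ i → pair x y i ⊑ y
        pair-below (lift false) = x⊑y
        pair-below (lift true)  = ⊑-refl y

        pair-isDirected : isDirected _⊑_ (pair x y)
        pair-isDirected = ∣ lift true ∣ , λ i j → ∣ lift true , pair-below i , pair-below j ∣

        pair-isSup : isSup _⊑_ (pair x y) y
        pair-isSup = pair-below , λ _ h → h (lift true)

      ≪-isProp : ∀ x y → isProp (x ≪ y)
      ≪-isProp x y p q = cong (λ h {I} → h I)
        (fe λ I → fe λ α → fe λ δ → fe λ y⊑⋁ → ∥∥-isProp (p {I} α δ y⊑⋁) (q α δ y⊑⋁))

      ≪⇒⊑ : ∀ {x y} → x ≪ y → x ⊑ y
      ≪⇒⊑ {x} {y} x≪y =
        ∥∥-rec (⊑-prop x y) (λ (i , x⊑) → ⊑-trans x⊑ (pair-below (⊑-refl y) i))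
          (≪-isSup _ (pair-isDirected (⊑-refl y)) x≪y (pair-isSup (⊑-refl y)))

      ⊑-≪-⊑ : ∀ {x y z w} → x ⊑ y → y ≪ z → z ⊑ w → x ≪ w
      ⊑-≪-⊑ x⊑y y≪z z⊑w α δ w⊑⋁ =
        ∥∥-map (λ (i , y⊑) → i , ⊑-trans x⊑y y⊑) (y≪z α δ (⊑-trans z⊑w w⊑⋁))

    module ScottContinuous {𝓥 𝓤 𝓣 𝓤′ 𝓣′} (D : DCPO 𝓥 𝓤 𝓣) (E : DCPO 𝓥 𝓤′ 𝓣′)
                           {f : ⟨ D ⟩ → ⟨ E ⟩} (f-sc : isScottContinuous D E f) where
      private
        module D = Dcpo D
        module E = Dcpo E

      monotone : ∀ {x y} → x D.⊑ y → f x E.⊑ f y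
      monotone {x} {y} x⊑y =
        subst (λ z → f x E.⊑ f z) (D.⋁-unique _ δ (D.pair-isSup x⊑y))
          (proj₁ (f-sc (D.pair x y) δ) (lift false))
        where δ = D.pair-isDirected x⊑y

      image-isDirected : ∀ {I : Set 𝓥} (α : I → ⟨ D ⟩)
                       → isDirected D._⊑_ α → isDirected E._⊑_ (f ∘ α)
      image-isDirected α (inh , semidir) =
        inh , λ i j → ∥∥-map (λ (k , ik , jk) → k , monotone ik , monotone jk) (semidir i j)

      ⊑-⋁-image : ∀ {I : Set 𝓥} (α : I → ⟨ D ⟩) (δ : isDirected D._⊑_ α)
                → f (D.⋁ α δ) E.⊑ E.⋁ (f ∘ α) (image-isDirected α δ)
      ⊑-⋁-image α δ = proj₂ (f-sc α δ) _ (E.⋁-upper _ _)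

    module _ {𝓥 𝓤 𝓣 𝓤′ 𝓣′} (D : DCPO 𝓥 𝓤 𝓣) (E : DCPO 𝓥 𝓤′ 𝓣′) where
      private
        module D = Dcpo D
        module E = Dcpo E

      ≅⇒isScottContinuous : (e : D ≅ E) → isScottContinuous D E (proj₁ e)
      ≅⇒isScottContinuous (f , g , gf , fg , f-mono , g-mono) α δ =
        (λ i → f-mono _ _ (D.⋁-upper α δ i)) ,
        λ y h → subst (f (D.⋁ α δ) E.⊑_) (fg y)
          (f-mono _ _ (D.⋁-least α δ (g y)
            (λ i → subst (D._⊑ g y) (gf (α i)) (g-mono _ _ (h i)))))

    module _ {𝓥 𝓤 𝓣 𝓤′ 𝓣′} (D : DCPO 𝓥 𝓤 𝓣) (E : DCPO 𝓥 𝓤′ 𝓣′) where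
      private
        module D = Dcpo D
        module E = Dcpo E

      ≅⇒◁ : D ≅ E → D ◁ E
      ≅⇒◁ e@(f , g , gf , _) =
        f , g , ≅⇒isScottContinuous D E e , ≅⇒isScottContinuous E D (≅-sym D E e) , gf

      ≅-preserves-compact : (e : D ≅ E) → ∀ x → isCompact D x → isCompact E (proj₁ e x)
      ≅-preserves-compact e@(f , g , gf , fg , f-mono , g-mono) x x-compact α δ fx⊑⋁ =
        ∥∥-map (λ (i , x⊑) → i , subst (f x E.⊑_) (fg (α i)) (f-mono _ _ x⊑))
          (x-compact (g ∘ α) (g.image-isDirected α δ)
            (subst (D._⊑ D.⋁ (g ∘ α) (g.image-isDirected α δ)) (gf x)
              (D.⊑-trans (g-mono _ _ fx⊑⋁) (g.⊑-⋁-image α δ))))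
        where module g = ScottContinuous E D {g} (≅⇒isScottContinuous E D (≅-sym D E e))

    module _ {𝓥 𝓤 𝓣 : Level} (D : DCPO 𝓥 𝓤 𝓣) where
      open Dcpo D

      record ApproximatingBasis : Set (lsuc 𝓥 ⊔ 𝓤 ⊔ 𝓣) where
        field
          B    : Set 𝓥
          β    : B → ⟨ D ⟩
          _≪ᵇ_ : B → ⟨ D ⟩ → Set 𝓥
          ≪ᵇ-isProp : ∀ b x → isProp (b ≪ᵇ x)
          ≪ᵇ⇒≪ : ∀ {b x} → b ≪ᵇ x → β b ≪ x
          ⊑-≪ᵇ : ∀ {a b x} → β a ⊑ β b → b ≪ᵇ x → a ≪ᵇ x
          ≪ᵇ-⊑ : ∀ {b x y} → b ≪ᵇ x → x ⊑ y → b ≪ᵇ y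
          ≪ᵇ-interpolation : ∀ {b x} → b ≪ᵇ x → ∥ Σ[ c ∈ B ] (b ≪ᵇ β c × c ≪ᵇ x) ∥
          approximants-isDirected : ∀ x → isDirected _⊑_ {Σ[ b ∈ B ] (b ≪ᵇ x)} (β ∘ proj₁)
          approximants-isSup : ∀ x → isSup _⊑_ {Σ[ b ∈ B ] (b ≪ᵇ x)} (β ∘ proj₁) x

        ≪ᵇ⇒⊑ : ∀ {b x} → b ≪ᵇ x → β b ⊑ x
        ≪ᵇ⇒⊑ = ≪⇒⊑ ∘ ≪ᵇ⇒≪

        ≪ᵇ-interpolation₂ : ∀ {a b x} → a ≪ᵇ x → b ≪ᵇ x
                          → ∥ Σ[ c ∈ B ] (c ≪ᵇ x × (a ≪ᵇ β c × b ≪ᵇ β c)) ∥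
        ≪ᵇ-interpolation₂ {x = x} a≪x b≪x =
          ∥∥-rec ∥∥-isProp (λ (c₁ , a≪c₁ , c₁≪x) →
          ∥∥-rec ∥∥-isProp (λ (c₂ , b≪c₂ , c₂≪x) →
          ∥∥-map (λ ((c , c≪x) , c₁⊑c , c₂⊑c) → c , c≪x , ≪ᵇ-⊑ a≪c₁ c₁⊑c , ≪ᵇ-⊑ b≪c₂ c₂⊑c)
            (proj₂ (approximants-isDirected x) (c₁ , c₁≪x) (c₂ , c₂≪x)))
            (≪ᵇ-interpolation b≪x))
            (≪ᵇ-interpolation a≪x)

        _⊑ᵇ_ : ⟨ D ⟩ → ⟨ D ⟩ → Set 𝓥
        x ⊑ᵇ y = ∀ b → b ≪ᵇ x → b ≪ᵇ y

        ⊑ᵇ-isProp : ∀ x y → isProp (x ⊑ᵇ y)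
        ⊑ᵇ-isProp x y = Π-isProp fe λ b → Π-isProp fe λ _ → ≪ᵇ-isProp b y

        ⊑ᵇ-refl : ∀ x → x ⊑ᵇ x
        ⊑ᵇ-refl _ _ b≪x = b≪x

        ⊑ᵇ-trans : ∀ {x y z} → x ⊑ᵇ y → y ⊑ᵇ z → x ⊑ᵇ z
        ⊑ᵇ-trans x⊑y y⊑z b = y⊑z b ∘ x⊑y b

        ⊑⇒⊑ᵇ : ∀ {x y} → x ⊑ y → x ⊑ᵇ y
        ⊑⇒⊑ᵇ x⊑y _ b≪x = ≪ᵇ-⊑ b≪x x⊑y

        ⊑ᵇ⇒⊑ : ∀ {x y} → x ⊑ᵇ y → x ⊑ y
        ⊑ᵇ⇒⊑ {x} {y} x⊑ᵇy = proj₂ (approximants-isSup x) y (λ (b , b≪x) → ≪ᵇ⇒⊑ (x⊑ᵇy b b≪x))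

      module SmallBasis {B : Set 𝓥} {β : B → ⟨ D ⟩} (sb : isSmallBasis D β) where

        _≪ᵇ_ : B → ⟨ D ⟩ → Set 𝓥
        b ≪ᵇ x = proj₁ (proj₂ (proj₂ sb) b x)

        ≪ᵇ⇒≪ : ∀ {b x} → b ≪ᵇ x → β b ≪ x
        ≪ᵇ⇒≪ {b} {x} = Inverse.to (proj₂ (proj₂ (proj₂ sb) b x))

        ≪⇒≪ᵇ : ∀ {b x} → β b ≪ x → b ≪ᵇ x
        ≪⇒≪ᵇ {b} {x} = Inverse.from (proj₂ (proj₂ (proj₂ sb) b x))

        ≪ᵇ-⊑ : ∀ {b x y} → b ≪ᵇ x → x ⊑ y → b ≪ᵇ y
        ≪ᵇ-⊑ b≪x x⊑y = ≪⇒≪ᵇ (⊑-≪-⊑ (⊑-refl _) (≪ᵇ⇒≪ b≪x) x⊑y)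

        Approximant : ⟨ D ⟩ → Set 𝓥
        Approximant x = Σ[ b ∈ B ] (b ≪ᵇ x)

        approximants-isDirected : ∀ x → isDirected _⊑_ {Approximant x} (β ∘ proj₁)
        approximants-isDirected x = isDirected-reindex _⊑_ β ≪⇒≪ᵇ ≪ᵇ⇒≪ (proj₁ sb x)

        approximants-isSup : ∀ x → isSup _⊑_ {Approximant x} (β ∘ proj₁) x
        approximants-isSup x = isSup-reindex _⊑_ β ≪⇒≪ᵇ ≪ᵇ⇒≪ (proj₁ (proj₂ sb) x)

        -- The approximants of the approximants of y are still directed with
        -- supremum y; way-belowness then yields interpolants.
        Approximant² : ⟨ D ⟩ → Set 𝓥
        Approximant² y = Σ[ (c , _) ∈ Approximant y ] Approximant (β c)

        approximants² : ∀ y → Approximant² y → ⟨ D ⟩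
        approximants² y (_ , (d , _)) = β d

        approximants²-isDirected : ∀ y → isDirected _⊑_ (approximants² y)
        approximants²-isDirected y =
          ∥∥-rec ∥∥-isProp (λ c → ∥∥-map (c ,_) (proj₁ (approximants-isDirected (β (proj₁ c)))))
            (proj₁ (approximants-isDirected y)) ,
          λ (c₁ , (d₁ , d₁≪c₁)) (c₂ , (d₂ , d₂≪c₂)) →
            ∥∥-rec ∥∥-isProp (λ ((c , c≪y) , c₁⊑c , c₂⊑c) →
              ∥∥-map (λ (e , d₁⊑e , d₂⊑e) → ((c , c≪y) , e) , d₁⊑e , d₂⊑e)
                (proj₂ (approximants-isDirected (β c))
                  (d₁ , ≪ᵇ-⊑ d₁≪c₁ c₁⊑c) (d₂ , ≪ᵇ-⊑ d₂≪c₂ c₂⊑c)))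
              (proj₂ (approximants-isDirected y) c₁ c₂)

        approximants²-isSup : ∀ y → isSup _⊑_ (approximants² y) y
        approximants²-isSup y =
          (λ ((_ , c≪y) , (_ , d≪c)) → ⊑-trans (≪⇒⊑ (≪ᵇ⇒≪ d≪c)) (≪⇒⊑ (≪ᵇ⇒≪ c≪y))) ,
          λ w h → proj₂ (approximants-isSup y) w
                    (λ c → proj₂ (approximants-isSup (β (proj₁ c))) w (λ d → h (c , d)))

        ≪ᵇ-interpolation : ∀ {b x} → b ≪ᵇ x → ∥ Σ[ c ∈ B ] (b ≪ᵇ β c × c ≪ᵇ x) ∥
        ≪ᵇ-interpolation {x = x} b≪x =
          ∥∥-map (λ (((c , c≪x) , (_ , d≪c)) , b⊑d) →
                    c , ≪⇒≪ᵇ (⊑-≪-⊑ b⊑d (≪ᵇ⇒≪ d≪c) (⊑-refl _)) , c≪x)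
            (≪-isSup _ (approximants²-isDirected x) (≪ᵇ⇒≪ b≪x) (approximants²-isSup x))

        approximatingBasis : ApproximatingBasis
        approximatingBasis = record
          { B = B
          ; β = β
          ; _≪ᵇ_ = _≪ᵇ_
          ; ≪ᵇ-isProp = λ b x → isProp-↔ (≪-isProp _ _) (proj₂ (proj₂ (proj₂ sb) b x))
          ; ≪ᵇ⇒≪ = ≪ᵇ⇒≪
          ; ⊑-≪ᵇ = λ a⊑b b≪x → ≪⇒≪ᵇ (⊑-≪-⊑ a⊑b (≪ᵇ⇒≪ b≪x) (⊑-refl _))
          ; ≪ᵇ-⊑ = ≪ᵇ-⊑
          ; ≪ᵇ-interpolation = ≪ᵇ-interpolation
          ; approximants-isDirected = approximants-isDirected
          ; approximants-isSup = approximants-isSup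
          }

      module SmallCompactBasis {B : Set 𝓥} {β : B → ⟨ D ⟩} (cb : isSmallCompactBasis D β) where

        _≪ᵇ_ : B → ⟨ D ⟩ → Set 𝓥
        b ≪ᵇ x = proj₁ (proj₂ (proj₂ (proj₂ cb)) b x)

        ≪ᵇ⇒⊑ : ∀ {b x} → b ≪ᵇ x → β b ⊑ x
        ≪ᵇ⇒⊑ {b} {x} = Inverse.to (proj₂ (proj₂ (proj₂ (proj₂ cb)) b x))

        ⊑⇒≪ᵇ : ∀ {b x} → β b ⊑ x → b ≪ᵇ x
        ⊑⇒≪ᵇ {b} {x} = Inverse.from (proj₂ (proj₂ (proj₂ (proj₂ cb)) b x))

        ≪ᵇ-refl : ∀ b → b ≪ᵇ β b
        ≪ᵇ-refl b = ⊑⇒≪ᵇ (⊑-refl _)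

        approximatingBasis : ApproximatingBasis
        approximatingBasis = record
          { B = B
          ; β = β
          ; _≪ᵇ_ = _≪ᵇ_
          ; ≪ᵇ-isProp = λ b x → isProp-↔ (⊑-prop _ _) (proj₂ (proj₂ (proj₂ (proj₂ cb)) b x))
          ; ≪ᵇ⇒≪ = λ {b} b⊑x → ⊑-≪-⊑ (⊑-refl _) (proj₁ cb b) (≪ᵇ⇒⊑ b⊑x)
          ; ⊑-≪ᵇ = λ a⊑b b⊑x → ⊑⇒≪ᵇ (⊑-trans a⊑b (≪ᵇ⇒⊑ b⊑x))
          ; ≪ᵇ-⊑ = λ b⊑x x⊑y → ⊑⇒≪ᵇ (⊑-trans (≪ᵇ⇒⊑ b⊑x) x⊑y)
          ; ≪ᵇ-interpolation = λ {b} b⊑x → ∣ b , ≪ᵇ-refl b , b⊑x ∣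
          ; approximants-isDirected = λ x → isDirected-reindex _⊑_ β ⊑⇒≪ᵇ ≪ᵇ⇒⊑ (proj₁ (proj₂ cb) x)
          ; approximants-isSup = λ x → isSup-reindex _⊑_ β ⊑⇒≪ᵇ ≪ᵇ⇒⊑ (proj₁ (proj₂ (proj₂ cb)) x)
          }

      isSmallBasis⇒isSmallCompactBasis : ∀ {B : Set 𝓥} {β : B → ⟨ D ⟩}
        → (∀ b → isCompact D (β b)) → isSmallBasis D β → isSmallCompactBasis D β
      isSmallBasis⇒isSmallCompactBasis {β = β} β-compact (dir , sup , small) =
        β-compact ,
        (λ x → isDirected-reindex _⊑_ β ≪⇒⊑ ⊑⇒≪ (dir x)) ,
        (λ x → isSup-reindex _⊑_ β ≪⇒⊑ ⊑⇒≪ (sup x)) ,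
        λ b x → isSmall-⇔ (≪-isProp _ _) (⊑-prop _ _) ≪⇒⊑ ⊑⇒≪ (small b x)
        where
        ⊑⇒≪ : ∀ {b x} → β b ⊑ x → β b ≪ x
        ⊑⇒≪ {b} = ⊑-≪-⊑ (⊑-refl _) (β-compact b)

    module RetractBasis {𝓥 𝓤 𝓣 𝓤′ 𝓣′} (D : DCPO 𝓥 𝓤 𝓣) (E : DCPO 𝓥 𝓤′ 𝓣′)
                        (ρ : D ◁ E) (𝒜 : ApproximatingBasis E) where
      private
        module D = Dcpo D
        module E = Dcpo E
      open ApproximatingBasis 𝒜

      s : ⟨ D ⟩ → ⟨ E ⟩
      s = proj₁ ρ

      r : ⟨ E ⟩ → ⟨ D ⟩
      r = proj₁ (proj₂ ρ)

      r∘s : ∀ x → r (s x) ≡ x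
      r∘s = proj₂ (proj₂ (proj₂ (proj₂ ρ)))

      private
        module s = ScottContinuous D E {s} (proj₁ (proj₂ (proj₂ ρ)))
        module r = ScottContinuous E D {r} (proj₁ (proj₂ (proj₂ (proj₂ ρ))))

      retract-≪ : ∀ {c x} → c ≪ᵇ s x → r (β c) D.≪ x
      retract-≪ {c} c≪sx α δ x⊑⋁ =
        ∥∥-map (λ (i , βc⊑) → i , subst (r (β c) D.⊑_) (r∘s (α i)) (r.monotone βc⊑))
          (≪ᵇ⇒≪ c≪sx (s ∘ α) (s.image-isDirected α δ)
            (E.⊑-trans (s.monotone x⊑⋁) (s.⊑-⋁-image α δ)))

      retracted-approximant : ∀ {x} → Σ[ c ∈ B ] (c ≪ᵇ s x) → Σ[ b ∈ B ] (r (β b) D.≪ x)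
      retracted-approximant (c , c≪sx) = c , retract-≪ c≪sx

      retracted-approximants-isDirected : ∀ x
        → isDirected D._⊑_ {Σ[ c ∈ B ] (c ≪ᵇ s x)} (r ∘ β ∘ proj₁)
      retracted-approximants-isDirected x =
        r.image-isDirected (β ∘ proj₁) (approximants-isDirected (s x))

      ⊑-⋁-retracted-approximants : ∀ x → x D.⊑ D.⋁ _ (retracted-approximants-isDirected x)
      ⊑-⋁-retracted-approximants x =
        subst (D._⊑ D.⋁ _ (retracted-approximants-isDirected x)) (r∘s x)
          (D.⊑-trans (r.monotone (E.isSup⇒⊑⋁ _ _ (approximants-isSup (s x))))
                     (r.⊑-⋁-image _ (approximants-isDirected (s x))))

      ≪⇒retracted-approximant : ∀ {b x} → r (β b) D.≪ x
                              → ∥ Σ[ c ∈ B ] (r (β b) D.⊑ r (β c) × c ≪ᵇ s x) ∥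
      ≪⇒retracted-approximant {x = x} rβb≪x =
        ∥∥-map (λ ((c , c≪sx) , rβb⊑) → c , rβb⊑ , c≪sx)
          (rβb≪x _ (retracted-approximants-isDirected x) (⊑-⋁-retracted-approximants x))

      s-reflects-⊑ : ∀ {x y} → s x E.⊑ s y → x D.⊑ y
      s-reflects-⊑ {x} {y} sx⊑sy = subst₂ D._⊑_ (r∘s x) (r∘s y) (r.monotone sx⊑sy)

      isSmallBasis-retract : isSmallBasis D (r ∘ β)
      isSmallBasis-retract = directed , sup , small
        where
        directed : ∀ x → isDirected D._⊑_ {Σ[ b ∈ B ] (r (β b) D.≪ x)} (r ∘ β ∘ proj₁)
        directed x =
          ∥∥-map retracted-approximant (proj₁ (approximants-isDirected (s x))) ,
          λ (b₁ , p₁) (b₂ , p₂) →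
            ∥∥-rec ∥∥-isProp (λ (c₁ , b₁⊑c₁ , w₁) →
            ∥∥-rec ∥∥-isProp (λ (c₂ , b₂⊑c₂ , w₂) →
            ∥∥-map (λ (c , c₁⊑c , c₂⊑c) →
                      retracted-approximant c , D.⊑-trans b₁⊑c₁ (r.monotone c₁⊑c)
                                              , D.⊑-trans b₂⊑c₂ (r.monotone c₂⊑c))
              (proj₂ (approximants-isDirected (s x)) (c₁ , w₁) (c₂ , w₂)))
            (≪⇒retracted-approximant p₂))
            (≪⇒retracted-approximant p₁)

        sup : ∀ x → isSup D._⊑_ {Σ[ b ∈ B ] (r (β b) D.≪ x)} (r ∘ β ∘ proj₁) x
        sup x =
          (λ (_ , rβb≪x) → D.≪⇒⊑ rβb≪x) ,
          λ y h → D.⊑-trans (⊑-⋁-retracted-approximants x)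
                    (D.⋁-least _ _ y (h ∘ retracted-approximant))

        small : ∀ b x → isSmall 𝓥 (r (β b) D.≪ x)
        small b x =
          ∥ Σ[ c ∈ B ] (s (r (β b)) ⊑ᵇ s (r (β c)) × c ≪ᵇ s x) ∥ ,
          props-↔ ∥∥-isProp (D.≪-isProp _ _)
            (∥∥-rec (D.≪-isProp _ _) λ (c , b⊑ᵇc , c≪sx) →
              D.⊑-≪-⊑ (s-reflects-⊑ (⊑ᵇ⇒⊑ b⊑ᵇc)) (retract-≪ c≪sx) (D.⊑-refl x))
            (∥∥-map (λ (c , b⊑c , c≪sx) → c , ⊑⇒⊑ᵇ (s.monotone b⊑c) , c≪sx)
              ∘ ≪⇒retracted-approximant)

    module _ {𝓥 𝓤 𝓣 𝓤′ 𝓣′} (D : DCPO 𝓥 𝓤 𝓣) (E : DCPO 𝓥 𝓤′ 𝓣′) where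

      hasSmallBasis-◁ : D ◁ E → ApproximatingBasis E → hasSmallBasis D
      hasSmallBasis-◁ ρ 𝒜 = ∣ _ , _ , RetractBasis.isSmallBasis-retract D E ρ 𝒜 ∣

      hasSmallCompactBasis-≅ : D ≅ E → hasSmallCompactBasis E → hasSmallCompactBasis D
      hasSmallCompactBasis-≅ e = ∥∥-map λ (B , β , cb) →
        B , _ ,
        isSmallBasis⇒isSmallCompactBasis D
          (λ b → ≅-preserves-compact E D (≅-sym D E e) (β b) (proj₁ cb b))
          (RetractBasis.isSmallBasis-retract D E (≅⇒◁ D E e)
            (SmallCompactBasis.approximatingBasis E cb))

    module _ (pe : PropExt) where

      module PrincipalIdeals {𝓥 : Level} (𝓑 : AbstractBasis 𝓥) where
        open AbstractBasis 𝓑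
        open Ideals 𝓑
        open Dcpo (Idl fe pe 𝓑)

        infix 30 ↓_
        ↓_ : B → Ideal
        ↓ b = mkIdeal (_≺ b) (λ a → ≺-prop a b) (λ a c a≺c c≺b → ≺-trans a c b a≺c c≺b)
                (≺-interpolation₀ b)
                (λ a₁ a₂ a₁≺b a₂≺b →
                  ∥∥-map (λ (a , (a₁≺a , a₂≺a) , a≺b) → a , a≺b , a₁≺a , a₂≺a)
                         (≺-interpolation₂ a₁ a₂ b a₁≺b a₂≺b))

        ↓-monotone : ∀ {b c} → b ≺ c → ↓ b ⊑ ↓ c
        ↓-monotone b≺c a a≺b = ≺-trans _ _ _ a≺b b≺c

        ∈⇒↓≪ : ∀ J {c} → J ∋ c → ↓ c ≪ J
        ∈⇒↓≪ J {c} c∈J α δ J⊆⋁ =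
          ∥∥-map (λ (i , c∈αi) → i , λ a a≺c → lower (α i) a c a≺c c∈αi) (J⊆⋁ c c∈J)

        principal-approximant : ∀ J → Σ[ c ∈ B ] (J ∋ c) → Σ[ b ∈ B ] (↓ b ≪ J)
        principal-approximant J (c , c∈J) = c , ∈⇒↓≪ J c∈J

        principal-subideals : (J : Ideal) → Σ[ c ∈ B ] (J ∋ c) → Ideal
        principal-subideals J = ↓_ ∘ proj₁

        principal-subideals-isDirected : ∀ J → isDirected _⊑_ (principal-subideals J)
        principal-subideals-isDirected J =
          inhabited J ,
          λ (c₁ , c₁∈J) (c₂ , c₂∈J) →
            ∥∥-map (λ (d , d∈J , c₁≺d , c₂≺d) → (d , d∈J) , ↓-monotone c₁≺d , ↓-monotone c₂≺d)
                   (semidirected J c₁ c₂ c₁∈J c₂∈J)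

        ⊑-⋁-principal-subideals : ∀ J
          → J ⊑ ⋁ (principal-subideals J) (principal-subideals-isDirected J)
        ⊑-⋁-principal-subideals J c c∈J =
          ∥∥-map (λ (d , d∈J , c≺d , _) → (d , d∈J) , c≺d) (semidirected J c c c∈J c∈J)

        ↓≪⇒ : ∀ b J → ↓ b ≪ J → ∥ Σ[ c ∈ B ] (J ∋ c × ↓ b ⊑ ↓ c) ∥
        ↓≪⇒ b J ↓b≪J =
          ∥∥-map (λ ((c , c∈J) , b⊑c) → c , c∈J , b⊑c)
            (↓b≪J (principal-subideals J) (principal-subideals-isDirected J)
                  (⊑-⋁-principal-subideals J))

        ↓-isSmallBasis : isSmallBasis (Idl fe pe 𝓑) ↓_
        ↓-isSmallBasis = directed , sup , small
          where
          directed : ∀ J → isDirected _⊑_ {Σ[ b ∈ B ] (↓ b ≪ J)} (↓_ ∘ proj₁)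
          directed J =
            ∥∥-map (principal-approximant J) (inhabited J) ,
            λ (b₁ , p₁) (b₂ , p₂) →
              ∥∥-rec ∥∥-isProp (λ (c₁ , c₁∈J , b₁⊑c₁) →
              ∥∥-rec ∥∥-isProp (λ (c₂ , c₂∈J , b₂⊑c₂) →
              ∥∥-map (λ (d , d∈J , c₁≺d , c₂≺d) →
                        principal-approximant J (d , d∈J)
                      , (λ a a≺b₁ → ↓-monotone c₁≺d a (b₁⊑c₁ a a≺b₁))
                      , (λ a a≺b₂ → ↓-monotone c₂≺d a (b₂⊑c₂ a a≺b₂)))
                (semidirected J c₁ c₂ c₁∈J c₂∈J))
              (↓≪⇒ b₂ J p₂))
              (↓≪⇒ b₁ J p₁)

          sup : ∀ J → isSup _⊑_ {Σ[ b ∈ B ] (↓ b ≪ J)} (↓_ ∘ proj₁) J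
          sup J =
            (λ (b , ↓b≪J) → ≪⇒⊑ {↓ b} {J} ↓b≪J) ,
            λ K h c c∈J → ⋁-least (principal-subideals J) (principal-subideals-isDirected J) K
                            (h ∘ principal-approximant J) c (⊑-⋁-principal-subideals J c c∈J)

          small : ∀ b J → isSmall 𝓥 (↓ b ≪ J)
          small b J =
            ∥ Σ[ c ∈ B ] (J ∋ c × ↓ b ⊑ ↓ c) ∥ ,
            props-↔ ∥∥-isProp (≪-isProp (↓ b) J)
              (∥∥-rec (≪-isProp (↓ b) J) λ (c , c∈J , b⊑c) →
                ⊑-≪-⊑ {↓ b} {↓ c} {J} {J} b⊑c (∈⇒↓≪ J c∈J) (⊑-refl J))
              (↓≪⇒ b J)

        Idl-hasSmallCompactBasis : (∀ b → b ≺ b) → hasSmallCompactBasis (Idl fe pe 𝓑)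
        Idl-hasSmallCompactBasis ≺-refl =
          ∣ B , ↓_ , isSmallBasis⇒isSmallCompactBasis (Idl fe pe 𝓑) {β = ↓_}
                       (λ b → ∈⇒↓≪ (↓ b) {b} (≺-refl b)) ↓-isSmallBasis ∣

      module IdealExtension {𝓥 𝓤 𝓣} (𝓑 : AbstractBasis 𝓥) {D : DCPO 𝓥 𝓤 𝓣}
                            (β : AbstractBasis.B 𝓑 → ⟨ D ⟩)
                            (β-monotone : ∀ {a b} → AbstractBasis._≺_ 𝓑 a b
                                                  → Dcpo._⊑_ D (β a) (β b))
                            where
        open AbstractBasis 𝓑
        open Ideals 𝓑
        private module D = Dcpo D

        members-isDirected : ∀ J → isDirected D._⊑_ {Σ[ b ∈ B ] (J ∋ b)} (β ∘ proj₁)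
        members-isDirected J =
          inhabited J ,
          λ (a , a∈J) (b , b∈J) →
            ∥∥-map (λ (c , c∈J , a≺c , b≺c) → (c , c∈J) , β-monotone a≺c , β-monotone b≺c)
                   (semidirected J a b a∈J b∈J)

        extension : Ideal → ⟨ D ⟩
        extension J = D.⋁ (β ∘ proj₁) (members-isDirected J)

        extension-monotone : ∀ {I J} → I ⊆ J → extension I D.⊑ extension J
        extension-monotone I⊆J = D.⋁-least _ _ _ (λ (b , b∈I) → D.⋁-upper _ _ (b , I⊆J b b∈I))

        extension-isScottContinuous : isScottContinuous (Idl fe pe 𝓑) D extension
        extension-isScottContinuous α δ =
          (λ i → extension-monotone {α i} {Dcpo.⋁ (Idl fe pe 𝓑) α δ} (λ b b∈αi → ∣ i , b∈αi ∣)) ,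
          λ y h → D.⋁-least _ _ y λ (b , b∈⋃) →
            ∥∥-rec (D.⊑-prop _ _) (λ (i , b∈αi) → D.⊑-trans (D.⋁-upper _ _ (b , b∈αi)) (h i)) b∈⋃

      module IdealPresentation {𝓥 𝓤 𝓣} {D : DCPO 𝓥 𝓤 𝓣} (𝒜 : ApproximatingBasis D) where
        open Dcpo D
        open ApproximatingBasis 𝒜

        approximationBasis : AbstractBasis 𝓥
        approximationBasis = record
          { B = B
          ; _≺_ = λ a b → a ≪ᵇ β b
          ; ≺-prop = λ a b → ≪ᵇ-isProp a (β b)
          ; ≺-trans = λ _ _ _ a≪b b≪c → ≪ᵇ-⊑ a≪b (≪ᵇ⇒⊑ b≪c)
          ; ≺-interpolation₀ = λ a → proj₁ (approximants-isDirected (β a))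
          ; ≺-interpolation₂ = λ _ _ _ a₁≪b a₂≪b →
              ∥∥-map (λ (c , c≪b , a₁≪c , a₂≪c) → c , (a₁≪c , a₂≪c) , c≪b)
                     (≪ᵇ-interpolation₂ a₁≪b a₂≪b)
          }

        open Ideals approximationBasis
        open IdealExtension approximationBasis {D = D} β ≪ᵇ⇒⊑

        approximants-ideal : ⟨ D ⟩ → Ideal
        approximants-ideal x =
          mkIdeal (_≪ᵇ x) (λ b → ≪ᵇ-isProp b x) (λ _ _ a≪b b≪x → ≪ᵇ-⊑ a≪b (≪ᵇ⇒⊑ b≪x))
                  (proj₁ (approximants-isDirected x)) (λ _ _ → ≪ᵇ-interpolation₂)

        extension-approximants : ∀ x → extension (approximants-ideal x) ≡ x
        extension-approximants x = ⋁-unique _ _ (approximants-isSup x)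

        approximants-extension : ∀ J → approximants-ideal (extension J) ≡ J
        approximants-extension J =
          Ideals.Construction.⊆-antisym approximationBasis fe pe _ _ ≪ᵇ-extension⇒∈ ∈⇒≪ᵇ-extension
          where
          ≪ᵇ-extension⇒∈ : ∀ b → b ≪ᵇ extension J → J ∋ b
          ≪ᵇ-extension⇒∈ b b≪J =
            ∥∥-rec (∋-prop J b) (λ (c , b≪c , c≪J) →
              ∥∥-rec (∋-prop J b) (λ ((d , d∈J) , c⊑d) → lower J b d (≪ᵇ-⊑ b≪c c⊑d) d∈J)
                (≪ᵇ⇒≪ c≪J _ (members-isDirected J) (⊑-refl _)))
              (≪ᵇ-interpolation b≪J)

          ∈⇒≪ᵇ-extension : ∀ b → J ∋ b → b ≪ᵇ extension J
          ∈⇒≪ᵇ-extension b b∈J =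
            ∥∥-rec (≪ᵇ-isProp _ _) (λ (c , c∈J , b≪c , _) → ≪ᵇ-⊑ b≪c (⋁-upper _ _ (c , c∈J)))
              (semidirected J b b b∈J b∈J)

        ≅-Idl : D ≅ Idl fe pe approximationBasis
        ≅-Idl = approximants-ideal , extension , extension-approximants , approximants-extension
              , (λ _ _ x⊑y b b≪x → ≪ᵇ-⊑ b≪x x⊑y) , (λ I J → extension-monotone {I} {J})

      module RetractOntoIdeals {𝓥 𝓤 𝓣} {D : DCPO 𝓥 𝓤 𝓣} (𝒜 : ApproximatingBasis D) where
        open Dcpo D
        open ApproximatingBasis 𝒜

        ⊑ᵇ-basis : AbstractBasis 𝓥
        ⊑ᵇ-basis = preorderBasis (λ a b → β a ⊑ᵇ β b) (λ _ _ → ⊑ᵇ-isProp _ _) (⊑ᵇ-refl ∘ β) ⊑ᵇ-trans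

        ⊑ᵇ-basis-isReflexive : ∀ b → AbstractBasis._≺_ ⊑ᵇ-basis b b
        ⊑ᵇ-basis-isReflexive = ⊑ᵇ-refl ∘ β

        open Ideals ⊑ᵇ-basis
        open IdealExtension ⊑ᵇ-basis {D = D} β ⊑ᵇ⇒⊑

        approximants-ideal : ⟨ D ⟩ → Ideal
        approximants-ideal x =
          mkIdeal (_≪ᵇ x) (λ b → ≪ᵇ-isProp b x) (λ _ _ a⊑b b≪x → ⊑-≪ᵇ (⊑ᵇ⇒⊑ a⊑b) b≪x)
            (proj₁ (approximants-isDirected x))
            (λ a b a≪x b≪x →
              ∥∥-map (λ ((c , c≪x) , a⊑c , b⊑c) → c , c≪x , ⊑⇒⊑ᵇ a⊑c , ⊑⇒⊑ᵇ b⊑c)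
                     (proj₂ (approximants-isDirected x) (a , a≪x) (b , b≪x)))

        approximants-ideal-isScottContinuous
          : isScottContinuous D (Idl fe pe ⊑ᵇ-basis) approximants-ideal
        approximants-ideal-isScottContinuous α δ =
          (λ i b b≪αi → ≪ᵇ-⊑ b≪αi (⋁-upper α δ i)) ,
          λ J h b b≪⋁ →
            ∥∥-rec (∋-prop J b) (λ (c , b≪c , c≪⋁) →
              ∥∥-rec (∋-prop J b) (λ (i , c⊑αi) → h i b (≪ᵇ-⊑ b≪c c⊑αi))
                (≪ᵇ⇒≪ c≪⋁ α δ (⊑-refl _)))
              (≪ᵇ-interpolation b≪⋁)

        ◁-Idl : D ◁ Idl fe pe ⊑ᵇ-basis
        ◁-Idl = approximants-ideal , extension , approximants-ideal-isScottContinuous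
              , extension-isScottContinuous , λ x → ⋁-unique _ _ (approximants-isSup x)

      module Characterisations {𝓥 𝓤 𝓣 : Level} (D : DCPO 𝓥 𝓤 𝓣) where

        hasSmallBasis⇒≅Idl : hasSmallBasis D → ∥ Σ[ 𝓑 ∈ AbstractBasis 𝓥 ] (D ≅ Idl fe pe 𝓑) ∥
        hasSmallBasis⇒≅Idl = ∥∥-map λ (_ , _ , sb) →
          let open IdealPresentation (SmallBasis.approximatingBasis D sb)
          in approximationBasis , ≅-Idl

        ≅Idl⇒hasSmallBasis : ∥ Σ[ 𝓑 ∈ AbstractBasis 𝓥 ] (D ≅ Idl fe pe 𝓑) ∥ → hasSmallBasis D
        ≅Idl⇒hasSmallBasis = ∥∥-rec ∥∥-isProp λ (𝓑 , e) →
          hasSmallBasis-◁ D (Idl fe pe 𝓑) (≅⇒◁ D (Idl fe pe 𝓑) e)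
            (SmallBasis.approximatingBasis (Idl fe pe 𝓑) {β = PrincipalIdeals.↓_ 𝓑}
              (PrincipalIdeals.↓-isSmallBasis 𝓑))

        hasSmallCompactBasis⇒≅Idl : hasSmallCompactBasis D
          → ∥ Σ[ 𝓑 ∈ AbstractBasis 𝓥 ] ((∀ b → AbstractBasis._≺_ 𝓑 b b) × (D ≅ Idl fe pe 𝓑)) ∥
        hasSmallCompactBasis⇒≅Idl = ∥∥-map λ (_ , _ , cb) →
          let open IdealPresentation (SmallCompactBasis.approximatingBasis D cb)
          in approximationBasis , SmallCompactBasis.≪ᵇ-refl D cb , ≅-Idl

        ≅Idl⇒hasSmallCompactBasis
          : ∥ Σ[ 𝓑 ∈ AbstractBasis 𝓥 ] ((∀ b → AbstractBasis._≺_ 𝓑 b b) × (D ≅ Idl fe pe 𝓑)) ∥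
          → hasSmallCompactBasis D
        ≅Idl⇒hasSmallCompactBasis = ∥∥-rec ∥∥-isProp λ (𝓑 , ≺-refl , e) →
          hasSmallCompactBasis-≅ D (Idl fe pe 𝓑) e
            (PrincipalIdeals.Idl-hasSmallCompactBasis 𝓑 ≺-refl)

        hasSmallBasis⇒◁-algebraic : hasSmallBasis D
          → ∥ Σ[ E ∈ DCPO 𝓥 (lsuc 𝓥) 𝓥 ] (hasSmallCompactBasis E × (D ◁ E)) ∥
        hasSmallBasis⇒◁-algebraic = ∥∥-map λ (_ , _ , sb) →
          let open RetractOntoIdeals (SmallBasis.approximatingBasis D sb)
          in Idl fe pe ⊑ᵇ-basis
           , PrincipalIdeals.Idl-hasSmallCompactBasis ⊑ᵇ-basis ⊑ᵇ-basis-isReflexive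
           , ◁-Idl

        ◁-algebraic⇒hasSmallBasis : ∀ {𝓤′ 𝓣′} (E : DCPO 𝓥 𝓤′ 𝓣′)
          → hasSmallCompactBasis E → D ◁ E → hasSmallBasis D
        ◁-algebraic⇒hasSmallBasis E hcb ρ = ∥∥-rec ∥∥-isProp from-compact-basis hcb
          where
          from-compact-basis : Σ[ B ∈ Set 𝓥 ] Σ[ β ∈ (B → ⟨ E ⟩) ] isSmallCompactBasis E β
                             → hasSmallBasis D
          from-compact-basis (_ , _ , cb) =
            hasSmallBasis-◁ D E ρ (SmallCompactBasis.approximatingBasis E cb)

        hasSmallBasis⇒≅-locally-small : hasSmallBasis D → ∥ Σ[ E ∈ DCPO 𝓥 (lsuc 𝓥) 𝓥 ] (D ≅ E) ∥
        hasSmallBasis⇒≅-locally-small = ∥∥-map (λ (𝓑 , e) → Idl fe pe 𝓑 , e) ∘ hasSmallBasis⇒≅Idl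

corollary6p32 : (fe : FunExt) (pe : PropExt) (pt : PropTrunc)
  → let open WithPT pt in
    ∀ {𝓥 𝓤 𝓣 𝓤' 𝓣' : Level} (D : DCPO 𝓥 𝓤 𝓣)
    -- (i)
  → ((hasSmallBasis D → ∥ Σ[ 𝓑 ∈ AbstractBasis 𝓥 ] (D ≅ Idl fe pe 𝓑) ∥)
     × (∥ Σ[ 𝓑 ∈ AbstractBasis 𝓥 ] (D ≅ Idl fe pe 𝓑) ∥ → hasSmallBasis D))
    -- (ii)
  × ((hasSmallCompactBasis D
        → ∥ Σ[ 𝓑 ∈ AbstractBasis 𝓥 ]
              ((∀ b → AbstractBasis._≺_ 𝓑 b b) × (D ≅ Idl fe pe 𝓑)) ∥)
     × (∥ Σ[ 𝓑 ∈ AbstractBasis 𝓥 ]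
              ((∀ b → AbstractBasis._≺_ 𝓑 b b) × (D ≅ Idl fe pe 𝓑)) ∥
        → hasSmallCompactBasis D))
    -- (iii)
  × ((hasSmallBasis D
        → ∥ Σ[ E ∈ DCPO 𝓥 (lsuc 𝓥) 𝓥 ] (hasSmallCompactBasis E × (D ◁ E)) ∥)
     × ((E : DCPO 𝓥 𝓤' 𝓣') → hasSmallCompactBasis E → D ◁ E → hasSmallBasis D))
    -- in particular
  × (hasSmallBasis D → ∥ Σ[ E ∈ DCPO 𝓥 (lsuc 𝓥) 𝓥 ] (D ≅ E) ∥)
corollary6p32 fe pe pt D =
    (hasSmallBasis⇒≅Idl , ≅Idl⇒hasSmallBasis)
  , (hasSmallCompactBasis⇒≅Idl , ≅Idl⇒hasSmallCompactBasis)
  , (hasSmallBasis⇒◁-algebraic , ◁-algebraic⇒hasSmallBasis)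
  , hasSmallBasis⇒≅-locally-small
  where open Characterisations pt fe pe D
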